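{- A unimodular system $\Omega=(U,[\xi_1,\ldots,\xi_N])$ has no multiple elements (i.e. there are no indices $i\neq j$ with $\xi_i=\pm\xi_j$) if and only if the lattice $L_{\Omega^\perp}$ of the Gale dual system has no roots (vectors $w$ with $\langle w,w\rangle=2$).
   Context: A unimodular system $(U,\Xi)$, $\Xi=[\xi_1,\ldots,\xi_N]$, is a real vector space $U$ of dimension $n$ with a finite multiset of nonzero linear forms such that every maximal linearly independent sub-collection of $\Xi$ generates over $\mathbb{Z}$ the same free abelian group of rank $n$ in $U^*$. For a system $\Omega$ with forms $\xi_1,\ldots,\xi_N$, $L_\Omega=W_\Omega\cap\mathbb{Z}^N$ where $W_\Omega=\{(\xi_1(u),\ldots,\xi_N(u)):u\in U\}$, with the standard inner product. The Gale dual $\Omega^\perp=(W_\Omega^\perp,\Xi^\perp)$: $W_\Omega^\perp$ is the orthogonal complement of $W_\Omega$ in $\mathbb{R}^N$ and $\Xi^\perp$ consists of those coordinate functions $z\mapsto\langle h_i,z\rangle$ ($h_i$ standard basis) that are nonzero on $W_\Omega^\perp$. -}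

module Defs where

open import Level using (Level; _⊔_)
open import Algebra.Bundles using (CommutativeRing)
open import Data.Nat as ℕ using (ℕ; zero; suc)
open import Data.Integer as ℤ using (ℤ; +_; -[1+_])
open import Data.Fin using (Fin; zero; suc)
open import Data.Fin.Subset using (Subset; _∈_; _∉_; _⊆_; ∣_∣)
open import Data.Product using (Σ; ∃; _×_; _,_)
open import Relation.Nullary using (¬_)
open import Relation.Binary.PropositionalEquality using (_≡_; _≢_)

record Field (c ℓ : Level) : Set (Level.suc (c ⊔ ℓ)) where
  field
    commutativeRing : CommutativeRing c ℓ
  open CommutativeRing commutativeRing public
  field
    1≉0     : ¬ (1# ≈ 0#)
    inverse : ∀ x → ¬ (x ≈ 0#) → Σ Carrier λ y → (x * y) ≈ 1#

module FieldDefs {c ℓ} (F : Field c ℓ) where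
  open Field F using (Carrier; _≈_; _+_; _*_; -_; 0#; 1#)

  ∑ : ∀ {m} → (Fin m → Carrier) → Carrier
  ∑ {zero}  f = 0#
  ∑ {suc m} f = f zero + ∑ (λ i → f (suc i))

  ℕ→K : ℕ → Carrier
  ℕ→K zero    = 0#
  ℕ→K (suc n) = 1# + ℕ→K n

  ι : ℤ → Carrier
  ι (+ n)      = ℕ→K n
  ι -[1+ n ]   = - ℕ→K (suc n)

  CharZero : Set ℓ
  CharZero = ∀ n → ¬ (ℕ→K (suc n) ≈ 0#)

  -- U = K^n (coordinates u : Fin n → K); U* = K^n, a form ξ acting by
  -- ξ(u) = ∑ₖ ξₖ uₖ.  A system with N forms is ξ : Fin N → Fin n → K.
  Form : ℕ → Set c
  Form n = Fin n → Carrier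

  eval : ∀ {n} → Form n → (Fin n → Carrier) → Carrier
  eval ξ u = ∑ λ k → ξ k * u k

  module System {n N : ℕ} (ξ : Fin N → Form n) where

    LinIndep : Subset N → Set (c ⊔ ℓ)
    LinIndep S = (a : Fin N → Carrier) → (∀ i → i ∉ S → a i ≈ 0#) →
                 (∀ k → ∑ (λ i → a i * ξ i k) ≈ 0#) → ∀ i → a i ≈ 0#

    MaxLinIndep : Subset N → Set (c ⊔ ℓ)
    MaxLinIndep S = LinIndep S × (∀ T → S ⊆ T → LinIndep T → T ⊆ S)

    InZSpan : Subset N → Form n → Set ℓ
    InZSpan S φ = Σ (Fin N → ℤ) λ a → (∀ i → i ∉ S → a i ≡ + 0) ×
                  (∀ k → ∑ (λ i → ι (a i) * ξ i k) ≈ φ k)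

    NonzeroForms : Set ℓ
    NonzeroForms = ∀ i → ¬ (∀ k → ξ i k ≈ 0#)

    -- unimodular: nonzero forms, every maximal linearly independent
    -- sub-collection generates over ℤ the same group, of rank n
    -- (the ℤ-span of an independent S is free of rank ∣ S ∣).
    Unimodular : Set (c ⊔ ℓ)
    Unimodular = NonzeroForms ×
      ((∀ S → MaxLinIndep S → ∣ S ∣ ≡ n) ×
       (∀ S T → MaxLinIndep S → MaxLinIndep T →
          ∀ φ → (InZSpan S φ → InZSpan T φ) × (InZSpan T φ → InZSpan S φ)))

    NoMultipleElements : Set ℓ
    NoMultipleElements = ∀ i j → i ≢ j →
      ¬ (∀ k → ξ i k ≈ ξ j k) × ¬ (∀ k → ξ i k ≈ - ξ j k)

    -- x ∈ W_Ω^⊥, W_Ω = {(ξ₁(u),…,ξ_N(u)) : u ∈ U}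
    InWperp : (Fin N → Carrier) → Set (c ⊔ ℓ)
    InWperp x = ∀ (u : Fin n → Carrier) → ∑ (λ i → x i * eval (ξ i) u) ≈ 0#

    -- L_{Ω^⊥} = W_Ω^⊥ ∩ ℤ^N (coordinates vanishing on W_Ω^⊥
    -- are dropped in Ξ^⊥, which gives an isometric copy)
    InDualLattice : (Fin N → ℤ) → Set (c ⊔ ℓ)
    InDualLattice z = InWperp (λ i → ι (z i))

  ⟨_,_⟩ℤ : ∀ {N} → (Fin N → ℤ) → (Fin N → ℤ) → ℤ
  ⟨_,_⟩ℤ {zero}  z w = + 0
  ⟨_,_⟩ℤ {suc N} z w = z zero ℤ.* w zero ℤ.+ ⟨ (λ i → z (suc i)) , (λ i → w (suc i)) ⟩ℤ

  module _ {n N : ℕ} (ξ : Fin N → Form n) where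
    open System ξ
    DualLatticeHasRoot : Set (c ⊔ ℓ)
    DualLatticeHasRoot = Σ (Fin N → ℤ) λ z → InDualLattice z × ⟨ z , z ⟩ℤ ≡ + 2

-- A vector of ℤ^N with ⟨z, z⟩ = 2 has exactly two nonzero entries, both ±1,
-- so the roots of ℤ^N are the vectors a eᵢ + b eⱼ with i ≠ j and a, b ∈ {±1}.
-- A vector x lies in W_Ω^⊥ iff ∑ᵢ xᵢ ξᵢ = 0 (test against the standard basis of U),
-- so a eᵢ + b eⱼ ∈ L_{Ω^⊥} iff a ξᵢ + b ξⱼ = 0, i.e. iff ξᵢ = ± ξⱼ.
module Submission where

open import Defs
open import Level using (Level)
open import Data.Nat using (ℕ)
open import Data.Fin using (Fin)
open import Relation.Nullary using (¬_)
open import Data.Product using (_×_)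

open import Data.Nat as ℕ using (zero; suc)
import Data.Nat.Properties as ℕ
open import Data.Fin using (zero; suc)
open import Data.Fin.Properties using (suc-injective)
open import Data.Integer as ℤ using (ℤ; +_; -[1+_]; ∣_∣)
import Data.Integer.Properties as ℤ
open import Data.Vec.Functional using (_∷_; head; tail)
open import Data.Vec.Functional.Properties using (∷-cong)
open import Data.Product using (_,_; proj₁; proj₂; ∃₂)
open import Data.Sum using (_⊎_; inj₁; inj₂)
open import Data.Empty using (⊥-elim)
open import Function using (_∘_; _⇔_; mk⇔; Equivalence)
open import Relation.Binary.PropositionalEquality as ≡ using (_≡_; _≢_; _≗_; cong)
import Algebra.Properties.Group as GroupProperties
import Algebra.Properties.Ring as RingProperties
import Algebra.Properties.Semiring.Sum as SemiringSum
import Relation.Binary.Reasoning.Setoid as SetoidReasoning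

data Unit : ℤ → Set where
  +1 : Unit (+ 1)
  −1 : Unit -[1+ 0 ]

sq : ℤ → ℕ
sq v = ∣ v ∣ ℕ.* ∣ v ∣

Unit⇒sq≡1 : ∀ {a} → Unit a → sq a ≡ 1
Unit⇒sq≡1 +1 = ≡.refl
Unit⇒sq≡1 −1 = ≡.refl

normSq : ∀ {N} → (Fin N → ℤ) → ℕ
normSq {zero}  z = 0
normSq {suc N} z = sq (head z) ℕ.+ normSq (tail z)

single : ∀ {N} → Fin N → ℤ → Fin N → ℤ
single zero    a = a ∷ λ _ → + 0
single (suc i) a = + 0 ∷ single i a

-- a eᵢ + b eⱼ; the value for i ≡ j is junk and never used.
pair : ∀ {N} → Fin N → ℤ → Fin N → ℤ → Fin N → ℤ
pair zero    a zero    b = λ _ → + 0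
pair zero    a (suc j) b = a ∷ single j b
pair (suc i) a zero    b = b ∷ single i a
pair (suc i) a (suc j) b = + 0 ∷ pair i a j b

normSq-zeros : ∀ N → normSq {N} (λ _ → + 0) ≡ 0
normSq-zeros zero    = ≡.refl
normSq-zeros (suc N) = normSq-zeros N

normSq-single : ∀ {N} (i : Fin N) a → normSq (single i a) ≡ sq a
normSq-single {suc N} zero a = ≡.trans (cong (sq a ℕ.+_) (normSq-zeros N)) (ℕ.+-identityʳ (sq a))
normSq-single (suc i) a = normSq-single i a

normSq-pair : ∀ {N} {i j : Fin N} a b → i ≢ j → normSq (pair i a j b) ≡ sq a ℕ.+ sq b
normSq-pair {i = zero}  {zero}  a b i≢j = ⊥-elim (i≢j ≡.refl)
normSq-pair {i = zero}  {suc j} a b _   = cong (sq a ℕ.+_) (normSq-single j b)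
normSq-pair {i = suc i} {zero}  a b _   =
  ≡.trans (cong (sq b ℕ.+_) (normSq-single i a)) (ℕ.+-comm (sq b) (sq a))
normSq-pair {i = suc i} {suc j} a b i≢j = normSq-pair a b (i≢j ∘ cong suc)

normSq≡0⇒zeros : ∀ {N} (z : Fin N → ℤ) → normSq z ≡ 0 → z ≗ λ _ → + 0
normSq≡0⇒zeros {suc N} z = from-head (head z) ≡.refl
  where
  from-head : ∀ v → head z ≡ v → sq v ℕ.+ normSq (tail z) ≡ 0 → z ≗ λ _ → + 0
  from-head (+ 0)      z₀≡v ∥t∥≡0 = ∷-cong z₀≡v (normSq≡0⇒zeros (tail z) ∥t∥≡0)
  from-head (+ suc _)  _    ()
  from-head -[1+ _ ]   _    ()

normSq≡1⇒single : ∀ {N} (z : Fin N → ℤ) → normSq z ≡ 1 →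
  ∃₂ λ j b → Unit b × z ≗ single j b
normSq≡1⇒single {suc N} z = from-head (head z) ≡.refl
  where
  from-head : ∀ v → head z ≡ v → sq v ℕ.+ normSq (tail z) ≡ 1 →
    ∃₂ λ j b → Unit b × z ≗ single j b
  from-head (+ 0) z₀≡v ∥t∥≡1 with normSq≡1⇒single (tail z) ∥t∥≡1
  ... | j , b , u , t≗ = suc j , b , u , ∷-cong z₀≡v t≗
  from-head (+ 1) z₀≡v 1+∥t∥≡1 =
    zero , + 1 , +1 , ∷-cong z₀≡v (normSq≡0⇒zeros (tail z) (ℕ.suc-injective 1+∥t∥≡1))
  from-head -[1+ 0 ] z₀≡v 1+∥t∥≡1 =
    zero , -[1+ 0 ] , −1 , ∷-cong z₀≡v (normSq≡0⇒zeros (tail z) (ℕ.suc-injective 1+∥t∥≡1))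
  from-head (+ suc (suc _)) _ ()
  from-head -[1+ suc _ ]    _ ()

normSq≡2⇒pair : ∀ {N} (z : Fin N → ℤ) → normSq z ≡ 2 →
  ∃₂ λ i j → i ≢ j × ∃₂ λ a b → Unit a × Unit b × z ≗ pair i a j b
normSq≡2⇒pair {suc N} z = from-head (head z) ≡.refl
  where
  Shape = ∃₂ λ i j → i ≢ j × ∃₂ λ a b → Unit a × Unit b × z ≗ pair i a j b
  unit-head : ∀ {a} → Unit a → head z ≡ a → normSq (tail z) ≡ 1 → Shape
  unit-head {a} u z₀≡a ∥t∥≡1 with normSq≡1⇒single (tail z) ∥t∥≡1
  ... | j , b , v , t≗ = zero , suc j , (λ ()) , a , b , u , v , ∷-cong z₀≡a t≗
  from-head : ∀ v → head z ≡ v → sq v ℕ.+ normSq (tail z) ≡ 2 → Shape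
  from-head (+ 0) z₀≡v ∥t∥≡2 with normSq≡2⇒pair (tail z) ∥t∥≡2
  ... | i , j , i≢j , a , b , u , v , t≗ =
    suc i , suc j , i≢j ∘ suc-injective , a , b , u , v , ∷-cong z₀≡v t≗
  from-head (+ 1)    z₀≡v 1+∥t∥≡2 = unit-head +1 z₀≡v (ℕ.suc-injective 1+∥t∥≡2)
  from-head -[1+ 0 ] z₀≡v 1+∥t∥≡2 = unit-head −1 z₀≡v (ℕ.suc-injective 1+∥t∥≡2)
  from-head (+ 2)                   _ ()
  from-head (+ suc (suc (suc _)))   _ ()
  from-head -[1+ 1 ]                _ ()
  from-head -[1+ suc (suc _) ]      _ ()

module _ {c ℓ} (F : Field c ℓ) where
  open Field F hiding (zero)
  open FieldDefs F
  open SetoidReasoning setoid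
  open GroupProperties +-group using (inverseˡ-unique; inverseʳ-unique; ⁻¹-involutive)
  open RingProperties ring using (-‿distribˡ-*)
  open SemiringSum semiring using (sum; sum-syntax; sum-cong-≋; sum-cong-≗; ∑-comm; *-distribˡ-sum; *-distribʳ-sum)

  ⟨z,z⟩≡normSq : ∀ {N} (z : Fin N → ℤ) → ⟨ z , z ⟩ℤ ≡ + normSq z
  ⟨z,z⟩≡normSq {zero}  z = ≡.refl
  ⟨z,z⟩≡normSq {suc N} z = ≡.cong₂ ℤ._+_ (i*i≡+sq (head z)) (⟨z,z⟩≡normSq (tail z))
    where
    i*i≡+sq : ∀ i → i ℤ.* i ≡ + sq i
    i*i≡+sq (+ n)    = ℤ.+◃n≡+n (n ℕ.* n)
    i*i≡+sq -[1+ n ] = ℤ.+◃n≡+n (suc n ℕ.* suc n)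

  signed : ∀ {a} → Unit a → Carrier → Carrier
  signed +1 x = x
  signed −1 x = - x

  ι-unit* : ∀ {a} (u : Unit a) x → ι a * x ≈ signed u x
  ι-unit* +1 x = trans (*-congʳ (+-identityʳ 1#)) (*-identityˡ x)
  ι-unit* −1 x = trans (sym (-‿distribˡ-* _ x)) (-‿cong (ι-unit* +1 x))

  ∑≡sum : ∀ {m} (f : Fin m → Carrier) → ∑ f ≡ sum f
  ∑≡sum {zero}  f = ≡.refl
  ∑≡sum {suc m} f = cong (_+_ (f zero)) (∑≡sum (tail f))

  ∑-cong : ∀ {m} {f g : Fin m → Carrier} → (∀ i → f i ≈ g i) → ∑ f ≈ ∑ g
  ∑-cong {zero}  f≈g = refl
  ∑-cong {suc m} f≈g = +-cong (f≈g zero) (∑-cong (f≈g ∘ suc))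

  ∑-0#* : ∀ {m} (g : Fin m → Carrier) → ∑ (λ l → 0# * g l) ≈ 0#
  ∑-0#* {zero}  g = refl
  ∑-0#* {suc m} g = trans (+-cong (zeroˡ (head g)) (∑-0#* (tail g))) (+-identityˡ 0#)

  ∑-ι-single : ∀ {N} (i : Fin N) a (g : Fin N → Carrier) →
    ∑ (λ l → ι (single i a l) * g l) ≈ ι a * g i
  ∑-ι-single zero    a g = trans (+-congˡ (∑-0#* (tail g))) (+-identityʳ _)
  ∑-ι-single (suc i) a g = trans (+-cong (zeroˡ (head g)) (∑-ι-single i a (tail g))) (+-identityˡ _)

  ∑-ι-pair : ∀ {N} {i j : Fin N} a b → i ≢ j → (g : Fin N → Carrier) →
    ∑ (λ l → ι (pair i a j b l) * g l) ≈ ι a * g i + ι b * g j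
  ∑-ι-pair {i = zero}  {zero}  a b i≢j g = ⊥-elim (i≢j ≡.refl)
  ∑-ι-pair {i = zero}  {suc j} a b _   g = +-congˡ (∑-ι-single j b (tail g))
  ∑-ι-pair {i = suc i} {zero}  a b _   g = trans (+-congˡ (∑-ι-single i a (tail g))) (+-comm _ _)
  ∑-ι-pair {i = suc i} {suc j} a b i≢j g =
    trans (+-cong (zeroˡ (head g)) (∑-ι-pair a b (i≢j ∘ cong suc) (tail g))) (+-identityˡ _)

  basis : ∀ {n} → Fin n → Fin n → Carrier
  basis k = ι ∘ single k (+ 1)

  eval-basis : ∀ {n} (φ : Form n) k → eval φ (basis k) ≈ φ k
  eval-basis φ k = begin
    ∑ (λ m → φ m * basis k m)  ≈⟨ ∑-cong (λ m → *-comm (φ m) (basis k m)) ⟩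
    ∑ (λ m → basis k m * φ m)  ≈⟨ ∑-ι-single k (+ 1) φ ⟩
    ι (+ 1) * φ k              ≈⟨ ι-unit* +1 (φ k) ⟩
    φ k                        ∎

  ⟨pair,pair⟩≡2 : ∀ {N} {i j : Fin N} {a b} → i ≢ j → Unit a → Unit b →
    ⟨ pair i a j b , pair i a j b ⟩ℤ ≡ + 2
  ⟨pair,pair⟩≡2 {i = i} {j} {a} {b} i≢j u v = ≡.trans (⟨z,z⟩≡normSq (pair i a j b))
    (cong +_ (≡.trans (normSq-pair a b i≢j) (≡.cong₂ ℕ._+_ (Unit⇒sq≡1 u) (Unit⇒sq≡1 v))))

  unit-relation : ∀ {m a b} {x y : Form m} → Unit a → Unit b →
    (∀ k → ι a * x k + ι b * y k ≈ 0#) → (∀ k → x k ≈ y k) ⊎ (∀ k → x k ≈ - y k)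
  unit-relation {x = x} {y} u v rel =
    signed-relation u v λ k → trans (sym (+-cong (ι-unit* u (x k)) (ι-unit* v (y k)))) (rel k)
    where
    signed-relation : ∀ {a b} (u : Unit a) (v : Unit b) →
      (∀ k → signed u (x k) + signed v (y k) ≈ 0#) → (∀ k → x k ≈ y k) ⊎ (∀ k → x k ≈ - y k)
    signed-relation +1 +1 r = inj₂ λ k → inverseˡ-unique (x k) (y k) (r k)
    signed-relation +1 −1 r = inj₁ λ k → trans (inverseˡ-unique (x k) (- y k) (r k)) (⁻¹-involutive (y k))
    signed-relation −1 +1 r = inj₁ λ k → sym (trans (inverseʳ-unique (- x k) (y k) (r k)) (⁻¹-involutive (x k)))
    signed-relation −1 −1 r = inj₂ λ k → sym (trans (inverseʳ-unique (- x k) (- y k) (r k)) (⁻¹-involutive (x k)))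

  module _ {n N : ℕ} (ξ : Fin N → Form n) where
    open System ξ

    LinearRelation : (Fin N → Carrier) → Set ℓ
    LinearRelation x = ∀ k → ∑ (λ i → x i * ξ i k) ≈ 0#

    InWperp⇒LinearRelation : ∀ x → InWperp x → LinearRelation x
    InWperp⇒LinearRelation x x⊥W k = begin
      ∑ (λ i → x i * ξ i k)                ≈⟨ ∑-cong (λ i → *-congˡ (sym (eval-basis (ξ i) k))) ⟩
      ∑ (λ i → x i * eval (ξ i) (basis k)) ≈⟨ x⊥W (basis k) ⟩
      0#                                   ∎

    LinearRelation⇒InWperp : ∀ x → LinearRelation x → InWperp x
    LinearRelation⇒InWperp x rel u = begin
      ∑ (λ i → x i * eval (ξ i) u)                  ≡⟨ ∑-as-sum ⟩
      ∑[ i < N ] (x i * ∑[ k < n ] (ξ i k * u k))   ≈⟨ sum-cong-≋ (λ i → *-distribˡ-sum (x i) (λ k → ξ i k * u k)) ⟩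
      ∑[ i < N ] ∑[ k < n ] (x i * (ξ i k * u k))   ≈⟨ sum-cong-≋ (λ i → sum-cong-≋ λ k → sym (*-assoc (x i) (ξ i k) (u k))) ⟩
      ∑[ i < N ] ∑[ k < n ] (x i * ξ i k * u k)     ≈⟨ ∑-comm (λ i k → x i * ξ i k * u k) ⟩
      ∑[ k < n ] ∑[ i < N ] (x i * ξ i k * u k)     ≈⟨ sum-cong-≋ (λ k → sym (*-distribʳ-sum (u k) (λ i → x i * ξ i k))) ⟩
      ∑[ k < n ] (∑[ i < N ] (x i * ξ i k) * u k)   ≈⟨ sum-cong-≋ (λ k → *-congʳ (rel-as-sum k)) ⟩
      ∑[ k < n ] (0# * u k)                         ≡⟨ ∑≡sum (λ k → 0# * u k) ⟨
      ∑ (λ k → 0# * u k)                            ≈⟨ ∑-0#* u ⟩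
      0#                                            ∎
      where
      ∑-as-sum : ∑ (λ i → x i * eval (ξ i) u) ≡ ∑[ i < N ] (x i * ∑[ k < n ] (ξ i k * u k))
      ∑-as-sum = ≡.trans (∑≡sum (λ i → x i * eval (ξ i) u))
                         (sum-cong-≗ {N} λ i → cong (x i *_) (∑≡sum (λ k → ξ i k * u k)))
      rel-as-sum : ∀ k → ∑[ i < N ] (x i * ξ i k) ≈ 0#
      rel-as-sum k = trans (reflexive (≡.sym (∑≡sum (λ i → x i * ξ i k)))) (rel k)

    InDualLattice-resp-≗ : ∀ {z w} → z ≗ w → InDualLattice z → InDualLattice w
    InDualLattice-resp-≗ z≗w z∈L u =
      trans (∑-cong λ i → reflexive (cong (λ t → ι t * eval (ξ i) u) (≡.sym (z≗w i)))) (z∈L u)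

    InDualLattice-pair⇔ : ∀ {i j : Fin N} a b → i ≢ j →
      InDualLattice (pair i a j b) ⇔ (∀ k → ι a * ξ i k + ι b * ξ j k ≈ 0#)
    InDualLattice-pair⇔ a b i≢j = mk⇔
      (λ pair∈L k → trans (sym (∑-ι-pair a b i≢j (λ l → ξ l k))) (InWperp⇒LinearRelation _ pair∈L k))
      (λ rel → LinearRelation⇒InWperp _ λ k → trans (∑-ι-pair a b i≢j (λ l → ξ l k)) (rel k))

    noMultiple⇒noRoot : NoMultipleElements → ¬ DualLatticeHasRoot ξ
    noMultiple⇒noRoot noMultiple (z , z∈L , ⟨z,z⟩≡2)
      with normSq≡2⇒pair z (ℤ.+-injective (≡.trans (≡.sym (⟨z,z⟩≡normSq z)) ⟨z,z⟩≡2))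
    ... | i , j , i≢j , a , b , u , v , z≗pair
      with unit-relation u v (Equivalence.to (InDualLattice-pair⇔ a b i≢j) (InDualLattice-resp-≗ z≗pair z∈L))
    ... | inj₁ ξᵢ≈ξⱼ  = proj₁ (noMultiple i j i≢j) ξᵢ≈ξⱼ
    ... | inj₂ ξᵢ≈-ξⱼ = proj₂ (noMultiple i j i≢j) ξᵢ≈-ξⱼ

    unit-relation⇒root : ∀ {i j : Fin N} {a b} → i ≢ j → Unit a → Unit b →
      (∀ k → ι a * ξ i k + ι b * ξ j k ≈ 0#) → DualLatticeHasRoot ξ
    unit-relation⇒root {i} {j} {a} {b} i≢j u v rel =
      pair i a j b , Equivalence.from (InDualLattice-pair⇔ a b i≢j) rel , ⟨pair,pair⟩≡2 i≢j u v

    noRoot⇒noMultiple : ¬ DualLatticeHasRoot ξ → NoMultipleElements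
    noRoot⇒noMultiple noRoot i j i≢j = ξᵢ≉ξⱼ , ξᵢ≉-ξⱼ
      where
      ξᵢ≉ξⱼ : ¬ (∀ k → ξ i k ≈ ξ j k)
      ξᵢ≉ξⱼ ξᵢ≈ξⱼ = noRoot (unit-relation⇒root i≢j +1 −1 λ k →
        trans (+-cong (ι-unit* +1 (ξ i k)) (ι-unit* −1 (ξ j k))) (trans (+-congʳ (ξᵢ≈ξⱼ k)) (-‿inverseʳ (ξ j k))))
      ξᵢ≉-ξⱼ : ¬ (∀ k → ξ i k ≈ - ξ j k)
      ξᵢ≉-ξⱼ ξᵢ≈-ξⱼ = noRoot (unit-relation⇒root i≢j +1 +1 λ k →
        trans (+-cong (ι-unit* +1 (ξ i k)) (ι-unit* +1 (ξ j k))) (trans (+-congʳ (ξᵢ≈-ξⱼ k)) (-‿inverseˡ (ξ j k))))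

mainTheorem14 : ∀ {c ℓ : Level} (F : Field c ℓ) → FieldDefs.CharZero F →
    (n N : ℕ) (ξ : Fin N → FieldDefs.Form F n) →
    FieldDefs.System.Unimodular F ξ →
    (FieldDefs.System.NoMultipleElements F ξ → ¬ FieldDefs.DualLatticeHasRoot F ξ) ×
    (¬ FieldDefs.DualLatticeHasRoot F ξ → FieldDefs.System.NoMultipleElements F ξ)
mainTheorem14 F _ n N ξ _ = noMultiple⇒noRoot F ξ , noRoot⇒noMultiple F ξ
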